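{- Let $V$ be a finite ground set, $f: 2^V \to \mathbb{R}_{\ge 0}$ a monotone submodular function, $c$ a modular cost function with $c(e) > 0$ for all $e \in V$, and $\beta > 0$. Let ${\rm OPT}_{\beta} \in \arg\max\{f(X) : X \subseteq V,\ c(X) \le \beta\}$ and let $o^* \in \arg\max_{e \in {\rm OPT}_{\beta}} c(e)$. Let $S \subseteq V$ satisfy $c(S) \le c({\rm OPT}_{\beta}) - c(o^*)$, and let $v$ be an element of ${\rm OPT}_{\beta} \setminus (S \cup \{o^*\})$ maximizing $\frac{f(e \mid S)}{c(e)}$ over $e \in {\rm OPT}_{\beta} \setminus (S \cup \{o^*\})$. Then \[ f(v \mid S) \ge \frac{c(v)}{c({\rm OPT}_{\beta}) - c(o^*)}\Big(f({\rm OPT}_{\beta}) - f(S \cup \{o^*\})\Big). \]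
   Context: A modular cost function means $c(S) = \sum_{s \in S} c(s)$. For $x \in V$, $S \subseteq V$: $f(x \mid S) = f(S \cup \{x\}) - f(S)$. -}

module Defs where

open import Level using (0ℓ)
open import Data.Nat using (ℕ; zero; suc)
open import Data.Fin using (Fin; zero; suc)
open import Data.Vec using ([]; _∷_)
open import Data.Fin.Subset using (Subset; inside; outside; _⊆_; _∪_; _∩_; ⁅_⁆)
open import Data.Product using (_×_; Σ; ∃)
open import Data.Sum using (_⊎_)
open import Relation.Binary.PropositionalEquality using (_≡_)
open import Relation.Nullary using (¬_)

-- An axiomatisation of the real numbers: a complete ordered field.
-- (Any two models are isomorphic, so quantifying over all models
-- is the same as speaking about ℝ.)
record RealField : Set₁ where
  infixl 6 _+_ _-_
  infixl 7 _*_ _/_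
  infix 4 _≤_ _<_ _≥_
  field
    ℝ   : Set
    0# 1# : ℝ
    _+_ _*_ : ℝ → ℝ → ℝ
    -_  : ℝ → ℝ
    _⁻¹ : ℝ → ℝ
    _≤_ : ℝ → ℝ → Set
    +-assoc : ∀ x y z → (x + y) + z ≡ x + (y + z)
    +-comm  : ∀ x y → x + y ≡ y + x
    +-identityˡ : ∀ x → 0# + x ≡ x
    -‿inverseˡ : ∀ x → (- x) + x ≡ 0#
    *-assoc : ∀ x y z → (x * y) * z ≡ x * (y * z)
    *-comm  : ∀ x y → x * y ≡ y * x
    *-identityˡ : ∀ x → 1# * x ≡ x
    distribˡ : ∀ x y z → x * (y + z) ≡ x * y + x * z
    0≢1 : ¬ (0# ≡ 1#)
    ⁻¹-inverseʳ : ∀ x → ¬ (x ≡ 0#) → x * (x ⁻¹) ≡ 1#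
    ≤-refl : ∀ x → x ≤ x
    ≤-trans : ∀ {x y z} → x ≤ y → y ≤ z → x ≤ z
    ≤-antisym : ∀ {x y} → x ≤ y → y ≤ x → x ≡ y
    ≤-total : ∀ x y → (x ≤ y) ⊎ (y ≤ x)
    +-mono-≤ : ∀ {x y} z → x ≤ y → x + z ≤ y + z
    *-nonneg : ∀ {x y} → 0# ≤ x → 0# ≤ y → 0# ≤ x * y
    lub : (P : ℝ → Set) → Σ ℝ P → Σ ℝ (λ b → ∀ x → P x → x ≤ b) →
          Σ ℝ (λ s → (∀ x → P x → x ≤ s) ×
                     (∀ b → (∀ x → P x → x ≤ b) → s ≤ b))

  _-_ : ℝ → ℝ → ℝ
  x - y = x + (- y)

  _/_ : ℝ → ℝ → ℝ
  x / y = x * (y ⁻¹)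

  _<_ : ℝ → ℝ → Set
  x < y = (x ≤ y) × ¬ (x ≡ y)

  _≥_ : ℝ → ℝ → Set
  x ≥ y = y ≤ x

  cost : ∀ {n} → (Fin n → ℝ) → Subset n → ℝ
  cost {zero}  c []             = 0#
  cost {suc n} c (inside  ∷ S)  = c zero + cost (λ i → c (suc i)) S
  cost {suc n} c (outside ∷ S)  = cost (λ i → c (suc i)) S

  marg : ∀ {n} → (Subset n → ℝ) → Fin n → Subset n → ℝ
  marg f x S = f (S ∪ ⁅ x ⁆) - f S

  Monotone : ∀ {n} → (Subset n → ℝ) → Set
  Monotone f = ∀ A B → A ⊆ B → f A ≤ f B

  Submodular : ∀ {n} → (Subset n → ℝ) → Set
  Submodular f = ∀ A B → f (A ∪ B) + f (A ∩ B) ≤ f A + f B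

  NonNegative : ∀ {n} → (Subset n → ℝ) → Set
  NonNegative f = ∀ X → 0# ≤ f X

{-# OPTIONS --safe #-}

-- Put A = S ∪ {o*} and T = OPT ∖ A. Monotonicity and submodularity give
--   f(OPT) - f(A) ≤ f(A ∪ T) - f(A) ≤ Σ_{e∈T} f(e | A) ≤ Σ_{e∈T} f(e | S),
-- and the choice of v bounds each summand by r c(e), where r = f(v | S) / c(v) ≥ 0. As
-- T ⊆ OPT ∖ {o*}, c(T) ≤ c(OPT) - c(o*), so f(OPT) - f(A) ≤ r (c(OPT) - c(o*)), which rearranges
-- to the claim because c(OPT) - c(o*) ≥ c(T) ≥ c(v) > 0.

module Submission where

open import Defs
open import Level using (0ℓ)
open import Algebra.Bundles using (CommutativeRing)
open import Algebra.Consequences.Propositional using (comm∧idˡ⇒id; comm∧invˡ⇒inv; comm∧distrˡ⇒distrʳ)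
import Algebra.Properties.Ring as RingProperties
import Algebra.Properties.CommutativeSemigroup as CommutativeSemigroupProperties
open import Relation.Binary.Bundles using (Poset)
import Relation.Binary.Reasoning.PartialOrder as PartialOrderReasoning
open import Data.Nat using (ℕ; zero; suc)
open import Data.Fin using (Fin; zero; suc)
open import Data.Vec using ([]; _∷_; here; there)
open import Data.Fin.Subset using (Subset; Side; inside; outside; _∈_; _∉_; _⊆_; _∪_; _∩_; ∁; ⁅_⁆; ⊥)
open import Data.Fin.Subset.Properties
  using ( _∈?_; x∈p∪q⁺; x∈p∪q⁻; x∈p∩q⁺; x∈p∩q⁻; x∈∁p⇒x∉p; x∉p⇒x∈∁p; x∈p⇒x∉∁p; x∈⁅x⁆; x≢y⇒x∉⁅y⁆
        ; x∉⁅y⁆⇒x≢y; p⊆p∪q; q⊆p∪q; p∩q⊆p; ⊆-refl; s⊆s; out⊆; drop-∷-⊆; ⊥⊆; ∉⊥; ∪-identityʳ )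
open import Data.Product using (_×_; _,_; proj₁; proj₂; map₂)
open import Data.Sum using (inj₁; inj₂; [_,_]′)
open import Function using (_∘_)
open import Relation.Binary.PropositionalEquality
  using (_≡_; _≢_; refl; sym; trans; cong; cong₂; subst₂; isEquivalence)
open import Relation.Nullary using (¬_; yes; no; contradiction)

x∉p∪q⁺ : ∀ {n} {x : Fin n} {p q : Subset n} → x ∉ p → x ∉ q → x ∉ p ∪ q
x∉p∪q⁺ {p = p} {q} x∉p x∉q = [ x∉p , x∉q ]′ ∘ x∈p∪q⁻ p q

x∉p∪q⁻ : ∀ {n} {x : Fin n} {p q : Subset n} → x ∉ p ∪ q → x ∉ p × x ∉ q
x∉p∪q⁻ x∉p∪q = x∉p∪q ∘ x∈p∪q⁺ ∘ inj₁ , x∉p∪q ∘ x∈p∪q⁺ ∘ inj₂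

x∈p∩∁q⁻ : ∀ {n} {x : Fin n} (p q : Subset n) → x ∈ p ∩ ∁ q → x ∈ p × x ∉ q
x∈p∩∁q⁻ p q x∈p∩∁q = map₂ x∈∁p⇒x∉p (x∈p∩q⁻ p (∁ q) x∈p∩∁q)

p⊆q∪[p∩∁q] : ∀ {n} (p q : Subset n) → p ⊆ q ∪ (p ∩ ∁ q)
p⊆q∪[p∩∁q] p q {x} x∈p with x ∈? q
... | yes x∈q = x∈p∪q⁺ (inj₁ x∈q)
... | no  x∉q = x∈p∪q⁺ (inj₂ (x∈p∩q⁺ (x∈p , x∉p⇒x∈∁p x∉q)))

s∷p⊆inside∷p : ∀ {n} s {p : Subset n} → s ∷ p ⊆ inside ∷ p
s∷p⊆inside∷p inside  = ⊆-refl
s∷p⊆inside∷p outside = out⊆ ⊆-refl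

s∷p∪⁅zero⁆≡inside∷p : ∀ {n} s (p : Subset n) → (s ∷ p) ∪ ⁅ zero ⁆ ≡ inside ∷ p
s∷p∪⁅zero⁆≡inside∷p inside  p = cong (inside ∷_) (∪-identityʳ p)
s∷p∪⁅zero⁆≡inside∷p outside p = cong (inside ∷_) (∪-identityʳ p)

module RealFieldProperties (R : RealField) where
  open RealField R renaming (+-mono-≤ to +-monoˡ-≤)

  commutativeRing : CommutativeRing 0ℓ 0ℓ
  commutativeRing = record
    { isCommutativeRing = record
      { isRing = record
        { +-isAbelianGroup = record
          { isGroup = record
            { isMonoid = record
              { isSemigroup = record
                { isMagma = record { isEquivalence = isEquivalence ; ∙-cong = cong₂ _+_ }
                ; assoc = +-assoc
                }
              ; identity = comm∧idˡ⇒id +-comm +-identityˡ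
              }
            ; inverse = comm∧invˡ⇒inv +-comm -‿inverseˡ
            ; ⁻¹-cong = cong (-_)
            }
          ; comm = +-comm
          }
        ; *-cong = cong₂ _*_
        ; *-assoc = *-assoc
        ; *-identity = comm∧idˡ⇒id *-comm *-identityˡ
        ; distrib = distribˡ , comm∧distrˡ⇒distrʳ *-comm distribˡ
        }
      ; *-comm = *-comm
      }
    }

  open CommutativeRing commutativeRing public using (+-identityʳ; zeroʳ)
  open CommutativeRing commutativeRing using (-‿inverseʳ; *-identityʳ; *-commutativeSemigroup; ring)
  open RingProperties ring
    using (//-rightDividesˡ; //-rightDividesʳ; xyx⁻¹≈y; x[y-z]≈xy-xz; -1*x≈-x; -‿involutive; -‿distribʳ-*)
  open CommutativeSemigroupProperties *-commutativeSemigroup using (xy∙z≈x∙zy)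

  ≤-poset : Poset 0ℓ 0ℓ 0ℓ
  ≤-poset = record
    { isPartialOrder = record
      { isPreorder = record
        { isEquivalence = isEquivalence
        ; reflexive = λ { refl → ≤-refl _ }
        ; trans = ≤-trans
        }
      ; antisym = ≤-antisym
      }
    }

  open Poset ≤-poset public using (≤-respˡ-≈; ≤-respʳ-≈) renaming (reflexive to ≤-reflexive)

  module ≤-Reasoning = PartialOrderReasoning ≤-poset

  <-≤-trans : ∀ {x y z} → x < y → y ≤ z → x < z
  <-≤-trans (x≤y , x≢y) y≤z = ≤-trans x≤y y≤z , λ { refl → x≢y (≤-antisym x≤y y≤z) }

  +-monoʳ-≤ : ∀ z {x y} → x ≤ y → z + x ≤ z + y
  +-monoʳ-≤ z {x} {y} x≤y = subst₂ _≤_ (+-comm x z) (+-comm y z) (+-monoˡ-≤ z x≤y)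

  +-mono-≤ : ∀ {x y u v} → x ≤ y → u ≤ v → x + u ≤ y + v
  +-mono-≤ {y = y} {u} x≤y u≤v = ≤-trans (+-monoˡ-≤ u x≤y) (+-monoʳ-≤ y u≤v)

  x≤y⇒x≤z+y : ∀ {x y z} → 0# ≤ z → x ≤ y → x ≤ z + y
  x≤y⇒x≤z+y {x} 0≤z x≤y = ≤-respˡ-≈ (+-identityˡ x) (+-mono-≤ 0≤z x≤y)

  x≤y⇒0≤y-x : ∀ {x y} → x ≤ y → 0# ≤ y - x
  x≤y⇒0≤y-x {x} x≤y = ≤-respˡ-≈ (-‿inverseʳ x) (+-monoˡ-≤ (- x) x≤y)

  0≤y-x⇒x≤y : ∀ {x y} → 0# ≤ y - x → x ≤ y
  0≤y-x⇒x≤y {x} {y} 0≤y-x = subst₂ _≤_ (+-identityˡ x) (//-rightDividesˡ x y) (+-monoˡ-≤ x 0≤y-x)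

  x+y≤z⇒x≤z-y : ∀ {x y z} → x + y ≤ z → x ≤ z - y
  x+y≤z⇒x≤z-y {x} {y} x+y≤z = ≤-respˡ-≈ (//-rightDividesʳ y x) (+-monoˡ-≤ (- y) x+y≤z)

  x≤y+z⇒x-y≤z : ∀ {x y z} → x ≤ y + z → x - y ≤ z
  x≤y+z⇒x-y≤z {y = y} {z} x≤y+z = ≤-respʳ-≈ (xyx⁻¹≈y y z) (+-monoˡ-≤ (- y) x≤y+z)

  x+[y-x]≡y : ∀ x y → x + (y - x) ≡ y
  x+[y-x]≡y x y = trans (+-comm x (y - x)) (//-rightDividesˡ x y)

  *-monoʳ-≤-nonNeg : ∀ {x y z} → 0# ≤ z → x ≤ y → z * x ≤ z * y
  *-monoʳ-≤-nonNeg {x} {y} {z} 0≤z x≤y =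
    0≤y-x⇒x≤y (≤-respʳ-≈ (x[y-z]≈xy-xz z y x) (*-nonneg 0≤z (x≤y⇒0≤y-x x≤y)))

  *-monoˡ-≤-nonNeg : ∀ {x y z} → 0# ≤ z → x ≤ y → x * z ≤ y * z
  *-monoˡ-≤-nonNeg {x} {y} {z} 0≤z x≤y = subst₂ _≤_ (*-comm z x) (*-comm z y) (*-monoʳ-≤-nonNeg 0≤z x≤y)

  x≤0⇒0≤-x : ∀ {x} → x ≤ 0# → 0# ≤ - x
  x≤0⇒0≤-x {x} x≤0 = ≤-respʳ-≈ (+-identityˡ (- x)) (x≤y⇒0≤y-x x≤0)

  0≤-x⇒x≤0 : ∀ {x} → 0# ≤ - x → x ≤ 0#
  0≤-x⇒x≤0 {x} 0≤-x = 0≤y-x⇒x≤y (≤-respʳ-≈ (sym (+-identityˡ (- x))) 0≤-x)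

  0≤1 : 0# ≤ 1#
  0≤1 with ≤-total 0# 1#
  ... | inj₁ 0≤1 = 0≤1
  ... | inj₂ 1≤0 = ≤-respʳ-≈ [-1][-1]≡1 (*-nonneg 0≤-1 0≤-1)
    where
    0≤-1 : 0# ≤ - 1#
    0≤-1 = x≤0⇒0≤-x 1≤0
    [-1][-1]≡1 : - 1# * - 1# ≡ 1#
    [-1][-1]≡1 = trans (-1*x≈-x (- 1#)) (-‿involutive 1#)

  positive⇒nonZero : ∀ {x} → 0# < x → x ≢ 0#
  positive⇒nonZero (_ , 0≢x) x≡0 = 0≢x (sym x≡0)

  ⁻¹-nonNeg : ∀ {x} → 0# < x → 0# ≤ x ⁻¹
  ⁻¹-nonNeg {x} 0<x@(0≤x , _) with ≤-total 0# (x ⁻¹)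
  ... | inj₁ 0≤x⁻¹ = 0≤x⁻¹
  ... | inj₂ x⁻¹≤0 = contradiction (≤-antisym 0≤1 1≤0) 0≢1
    where
    x*[-x⁻¹]≡-1 : x * - (x ⁻¹) ≡ - 1#
    x*[-x⁻¹]≡-1 = trans (sym (-‿distribʳ-* x (x ⁻¹))) (cong (-_) (⁻¹-inverseʳ x (positive⇒nonZero 0<x)))
    1≤0 : 1# ≤ 0#
    1≤0 = 0≤-x⇒x≤0 (≤-respʳ-≈ x*[-x⁻¹]≡-1 (*-nonneg 0≤x (x≤0⇒0≤-x x⁻¹≤0)))

  x/y*y≡x : ∀ x {y} → y ≢ 0# → (x / y) * y ≡ x
  x/y*y≡x x {y} y≢0 = trans (xy∙z≈x∙zy x (y ⁻¹) y) (trans (cong (x *_) (⁻¹-inverseʳ y y≢0)) (*-identityʳ x))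

  x*y/y≡x : ∀ x {y} → y ≢ 0# → (x * y) / y ≡ x
  x*y/y≡x x {y} y≢0 = trans (*-assoc x y (y ⁻¹)) (trans (cong (x *_) (⁻¹-inverseʳ y y≢0)) (*-identityʳ x))

  x*[y/x]≡y : ∀ {x} y → x ≢ 0# → x * (y / x) ≡ y
  x*[y/x]≡y {x} y x≢0 = trans (*-comm x (y / x)) (x/y*y≡x y x≢0)

  x/y≤z⇒x≤z*y : ∀ {x y z} → 0# < y → x / y ≤ z → x ≤ z * y
  x/y≤z⇒x≤z*y {x} 0<y@(0≤y , _) x/y≤z =
    ≤-respˡ-≈ (x/y*y≡x x (positive⇒nonZero 0<y)) (*-monoˡ-≤-nonNeg 0≤y x/y≤z)

  x≤y*z⇒x/z≤y : ∀ {x y z} → 0# < z → x ≤ y * z → x / z ≤ y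
  x≤y*z⇒x/z≤y {y = y} 0<z x≤y*z =
    ≤-respʳ-≈ (x*y/y≡x y (positive⇒nonZero 0<z)) (*-monoˡ-≤-nonNeg (⁻¹-nonNeg 0<z) x≤y*z)

  x≤[y/z]*w⇒[z/w]*x≤y : ∀ {x y z w} → 0# < z → 0# < w → x ≤ (y / z) * w → (z / w) * x ≤ y
  x≤[y/z]*w⇒[z/w]*x≤y {x} {y} {z} {w} 0<z@(0≤z , _) 0<w x≤[y/z]*w = begin
    (z / w) * x  ≡⟨ xy∙z≈x∙zy z (w ⁻¹) x ⟩
    z * (x / w)  ≤⟨ *-monoʳ-≤-nonNeg 0≤z (x≤y*z⇒x/z≤y 0<w x≤[y/z]*w) ⟩
    z * (y / z)  ≡⟨ x*[y/x]≡y y (positive⇒nonZero 0<z) ⟩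
    y            ∎
    where open ≤-Reasoning

module CostProperties (R : RealField) where
  open RealField R hiding (+-mono-≤)
  open RealFieldProperties R

  cost-monoˡ : ∀ {n} (g h : Fin n → ℝ) (B : Subset n) → (∀ e → e ∈ B → g e ≤ h e) → cost g B ≤ cost h B
  cost-monoˡ {zero}  g h []            g≤h = ≤-refl 0#
  cost-monoˡ {suc n} g h (inside ∷ B)  g≤h =
    +-mono-≤ (g≤h zero here) (cost-monoˡ (g ∘ suc) (h ∘ suc) B (λ e e∈B → g≤h (suc e) (there e∈B)))
  cost-monoˡ {suc n} g h (outside ∷ B) g≤h =
    cost-monoˡ (g ∘ suc) (h ∘ suc) B (λ e e∈B → g≤h (suc e) (there e∈B))

  cost-scale : ∀ {n} r (c : Fin n → ℝ) (B : Subset n) → cost (λ e → r * c e) B ≡ r * cost c B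
  cost-scale {zero}  r c []            = sym (zeroʳ r)
  cost-scale {suc n} r c (inside ∷ B)  =
    trans (cong (r * c zero +_) (cost-scale r (c ∘ suc) B)) (sym (distribˡ r (c zero) _))
  cost-scale {suc n} r c (outside ∷ B) = cost-scale r (c ∘ suc) B

  cost-nonNeg : ∀ {n} (c : Fin n → ℝ) → (∀ e → 0# ≤ c e) → (B : Subset n) → 0# ≤ cost c B
  cost-nonNeg {zero}  c 0≤c []            = ≤-refl 0#
  cost-nonNeg {suc n} c 0≤c (inside ∷ B)  = x≤y⇒x≤z+y (0≤c zero) (cost-nonNeg (c ∘ suc) (0≤c ∘ suc) B)
  cost-nonNeg {suc n} c 0≤c (outside ∷ B) = cost-nonNeg (c ∘ suc) (0≤c ∘ suc) B

  cost-monoʳ : ∀ {n} (c : Fin n → ℝ) → (∀ e → 0# ≤ c e) → (T P : Subset n) → T ⊆ P → cost c T ≤ cost c P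
  cost-monoʳ {zero}  c 0≤c []            []            T⊆P = ≤-refl 0#
  cost-monoʳ {suc n} c 0≤c (inside ∷ T)  (inside ∷ P)  T⊆P =
    +-monoʳ-≤ (c zero) (cost-monoʳ (c ∘ suc) (0≤c ∘ suc) T P (drop-∷-⊆ T⊆P))
  cost-monoʳ {suc n} c 0≤c (inside ∷ T)  (outside ∷ P) T⊆P = contradiction (T⊆P here) λ ()
  cost-monoʳ {suc n} c 0≤c (outside ∷ T) (inside ∷ P)  T⊆P =
    x≤y⇒x≤z+y (0≤c zero) (cost-monoʳ (c ∘ suc) (0≤c ∘ suc) T P (drop-∷-⊆ T⊆P))
  cost-monoʳ {suc n} c 0≤c (outside ∷ T) (outside ∷ P) T⊆P =
    cost-monoʳ (c ∘ suc) (0≤c ∘ suc) T P (drop-∷-⊆ T⊆P)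

  cost-⊆-∉ : ∀ {n} (c : Fin n → ℝ) → (∀ e → 0# ≤ c e) → (T P : Subset n) {o : Fin n} →
             T ⊆ P → o ∈ P → o ∉ T → cost c T + c o ≤ cost c P
  cost-⊆-∉ c 0≤c (inside ∷ T)  (inside ∷ P)  {zero}  T⊆P here o∉T = contradiction here o∉T
  cost-⊆-∉ c 0≤c (outside ∷ T) (inside ∷ P)  {zero}  T⊆P here o∉T =
    ≤-respˡ-≈ (+-comm (c zero) _) (+-monoʳ-≤ (c zero) (cost-monoʳ (c ∘ suc) (0≤c ∘ suc) T P (drop-∷-⊆ T⊆P)))
  cost-⊆-∉ c 0≤c (inside ∷ T)  (inside ∷ P)  {suc o} T⊆P (there o∈P) o∉T =
    ≤-respˡ-≈ (sym (+-assoc (c zero) _ _))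
      (+-monoʳ-≤ (c zero) (cost-⊆-∉ (c ∘ suc) (0≤c ∘ suc) T P (drop-∷-⊆ T⊆P) o∈P (o∉T ∘ there)))
  cost-⊆-∉ c 0≤c (inside ∷ T)  (outside ∷ P) {suc o} T⊆P (there o∈P) o∉T = contradiction (T⊆P here) λ ()
  cost-⊆-∉ c 0≤c (outside ∷ T) (inside ∷ P)  {suc o} T⊆P (there o∈P) o∉T =
    x≤y⇒x≤z+y (0≤c zero) (cost-⊆-∉ (c ∘ suc) (0≤c ∘ suc) T P (drop-∷-⊆ T⊆P) o∈P (o∉T ∘ there))
  cost-⊆-∉ c 0≤c (outside ∷ T) (outside ∷ P) {suc o} T⊆P (there o∈P) o∉T =
    cost-⊆-∉ (c ∘ suc) (0≤c ∘ suc) T P (drop-∷-⊆ T⊆P) o∈P (o∉T ∘ there)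

  ∈⇒≤cost : ∀ {n} (c : Fin n → ℝ) → (∀ e → 0# ≤ c e) → (P : Subset n) {e : Fin n} → e ∈ P → c e ≤ cost c P
  ∈⇒≤cost c 0≤c P e∈P =
    ≤-trans (x≤y⇒x≤z+y (cost-nonNeg c 0≤c ⊥) (≤-refl _)) (cost-⊆-∉ c 0≤c ⊥ P ⊥⊆ e∈P ∉⊥)

  cost-∩∁-≤ : ∀ {n} (c : Fin n → ℝ) → (∀ e → 0# ≤ c e) → {P A : Subset n} {o : Fin n} →
             o ∈ P → o ∈ A → cost c (P ∩ ∁ A) ≤ cost c P - c o
  cost-∩∁-≤ c 0≤c {P} {A} o∈P o∈A =
    x+y≤z⇒x≤z-y (cost-⊆-∉ c 0≤c (P ∩ ∁ A) P (p∩q⊆p P (∁ A)) o∈P (x∈p⇒x∉∁p o∈A ∘ proj₂ ∘ x∈p∩q⁻ P (∁ A)))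

module SubmodularProperties (R : RealField) where
  open RealField R hiding (+-mono-≤)
  open RealFieldProperties R
  open CostProperties R
  open ≤-Reasoning

  fixHead : ∀ {n} → Side → (Subset (suc n) → ℝ) → Subset n → ℝ
  fixHead s f X = f (s ∷ X)

  fixHead-monotone : ∀ {n} s {f : Subset (suc n) → ℝ} → Monotone f → Monotone (fixHead s f)
  fixHead-monotone s mono A B A⊆B = mono (s ∷ A) (s ∷ B) (s⊆s A⊆B)

  fixHead-submodular : ∀ {n} s {f : Subset (suc n) → ℝ} → Submodular f → Submodular (fixHead s f)
  fixHead-submodular inside  sub A B = sub (inside ∷ A) (inside ∷ B)
  fixHead-submodular outside sub A B = sub (outside ∷ A) (outside ∷ B)

  marg-antitone : ∀ {n} {f : Subset n → ℝ} → Monotone f → Submodular f →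
                  ∀ {X Y} e → X ⊆ Y → marg f e Y ≤ marg f e X
  marg-antitone {f = f} mono sub {X} {Y} e X⊆Y =
    x≤y+z⇒x-y≤z (≤-respʳ-≈ (+-assoc (f Y) _ _) (x+y≤z⇒x≤z-y (begin
      f (Y ∪ ⁅ e ⁆) + f X                        ≤⟨ +-mono-≤ (mono _ _ Y∪e⊆) (mono _ _ X⊆) ⟩
      f (Y ∪ (X ∪ ⁅ e ⁆)) + f (Y ∩ (X ∪ ⁅ e ⁆))  ≤⟨ sub Y (X ∪ ⁅ e ⁆) ⟩
      f Y + f (X ∪ ⁅ e ⁆)                        ∎)))
    where
    Y∪e⊆ : Y ∪ ⁅ e ⁆ ⊆ Y ∪ (X ∪ ⁅ e ⁆)
    Y∪e⊆ = [ p⊆p∪q _ , q⊆p∪q Y _ ∘ q⊆p∪q X _ ]′ ∘ x∈p∪q⁻ Y ⁅ e ⁆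
    X⊆ : X ⊆ Y ∩ (X ∪ ⁅ e ⁆)
    X⊆ x∈X = x∈p∩q⁺ (X⊆Y x∈X , p⊆p∪q _ x∈X)

  f-∪≤f+Σmarg : ∀ {n} (f : Subset n → ℝ) → Monotone f → Submodular f → ∀ A B →
                f (A ∪ B) ≤ f A + cost (λ e → marg f e A) B
  f-∪≤f+Σmarg {zero}  f _    _   []      []      = ≤-reflexive (sym (+-identityʳ (f [])))
  f-∪≤f+Σmarg {suc n} f mono sub (s ∷ A) (t ∷ B) = step s t
    where
    tail : ∀ s → fixHead s f (A ∪ B) ≤ fixHead s f A + cost (λ e → marg (fixHead s f) e A) B
    tail s = f-∪≤f+Σmarg (fixHead s f) (fixHead-monotone s mono) (fixHead-submodular s sub) A B

    Σ : Side → ℝ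
    Σ s = cost (λ i → marg f (suc i) (s ∷ A)) B

    add-head : ∀ s → f (inside ∷ (A ∪ B)) ≤ f (s ∷ A) + (marg f zero (s ∷ A) + Σ s)
    add-head s = begin
      f (inside ∷ (A ∪ B))                                ≤⟨ tail inside ⟩
      f (inside ∷ A) + Σ inside                           ≤⟨ +-monoʳ-≤ _ (cost-monoˡ _ _ B λ i _ →
                                                               marg-antitone mono sub (suc i) (s∷p⊆inside∷p s)) ⟩
      f (inside ∷ A) + Σ s                                ≡⟨ cong (_+ Σ s) (x+[y-x]≡y (f (s ∷ A)) _) ⟨
      f (s ∷ A) + (f (inside ∷ A) - f (s ∷ A)) + Σ s      ≡⟨ +-assoc (f (s ∷ A)) _ (Σ s) ⟩
      f (s ∷ A) + (f (inside ∷ A) - f (s ∷ A) + Σ s)      ≡⟨ cong (λ X → f (s ∷ A) + (f X - f (s ∷ A) + Σ s))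
                                                               (s∷p∪⁅zero⁆≡inside∷p s A) ⟨
      f (s ∷ A) + (marg f zero (s ∷ A) + Σ s)             ∎

    -- s ∨ inside and s ∨ outside only reduce for a concrete side s, hence the four cases.
    step : ∀ s t → f ((s ∷ A) ∪ (t ∷ B)) ≤ f (s ∷ A) + cost (λ e → marg f e (s ∷ A)) (t ∷ B)
    step inside  inside  = add-head inside
    step outside inside  = add-head outside
    step inside  outside = tail inside
    step outside outside = tail outside

  gain≤ratio*cost : ∀ {n} {f : Subset n → ℝ} → Monotone f → Submodular f → (c : Fin n → ℝ) (r : ℝ) →
                    ∀ {S A P} → S ⊆ A → (∀ e → e ∈ P ∩ ∁ A → marg f e S ≤ r * c e) →
                    f P - f A ≤ r * cost c (P ∩ ∁ A)
  gain≤ratio*cost {f = f} mono sub c r {S} {A} {P} S⊆A marg≤r*c = x≤y+z⇒x-y≤z (begin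
    f P                                      ≤⟨ mono P (A ∪ T) (p⊆q∪[p∩∁q] P A) ⟩
    f (A ∪ T)                                ≤⟨ f-∪≤f+Σmarg f mono sub A T ⟩
    f A + cost (λ e → marg f e A) T          ≤⟨ +-monoʳ-≤ (f A) (cost-monoˡ _ _ T λ e e∈T →
                                                  ≤-trans (marg-antitone mono sub e S⊆A) (marg≤r*c e e∈T)) ⟩
    f A + cost (λ e → r * c e) T             ≡⟨ cong (f A +_) (cost-scale r c T) ⟩
    f A + r * cost c T                       ∎)
    where
    T = P ∩ ∁ A

lemma2 : (R : RealField) → let open RealField R in
    (n : ℕ) (f : Subset n → ℝ) (c : Fin n → ℝ) (β : ℝ)
    (OPT S : Subset n) (o* v : Fin n) →
    NonNegative f → Monotone f → Submodular f →
    (∀ e → 0# < c e) → 0# < β →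
    cost c OPT ≤ β → (∀ X → cost c X ≤ β → f X ≤ f OPT) →
    o* ∈ OPT → (∀ e → e ∈ OPT → c e ≤ c o*) →
    cost c S ≤ cost c OPT - c o* →
    v ∈ OPT → v ∉ S → ¬ (v ≡ o*) →
    (∀ e → e ∈ OPT → e ∉ S → ¬ (e ≡ o*) →
    marg f e S / c e ≤ marg f v S / c v) →
    marg f v S ≥ (c v / (cost c OPT - c o*)) * (f OPT - f (S ∪ ⁅ o* ⁆))
lemma2 R n f c β OPT S o* v _ mono sub c>0 _ _ _ o*∈OPT _ _ v∈OPT v∉S v≢o* v-best =
  x≤[y/z]*w⇒[z/w]*x≤y (c>0 v) 0<D (≤-trans gap≤r*cT (*-monoʳ-≤-nonNeg 0≤r cT≤D))
  where
  open RealField R hiding (+-mono-≤)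
  open RealFieldProperties R
  open CostProperties R
  open SubmodularProperties R

  A = S ∪ ⁅ o* ⁆
  T = OPT ∩ ∁ A
  r = marg f v S / c v

  0≤c : ∀ e → 0# ≤ c e
  0≤c = proj₁ ∘ c>0

  gap≤r*cT : f OPT - f A ≤ r * cost c T
  gap≤r*cT = gain≤ratio*cost mono sub c r (p⊆p∪q ⁅ o* ⁆) λ e e∈T →
    let e∈OPT , e∉A = x∈p∩∁q⁻ OPT A e∈T
        e∉S , e∉⁅o*⁆ = x∉p∪q⁻ e∉A
    in x/y≤z⇒x≤z*y (c>0 e) (v-best e e∈OPT e∉S (x∉⁅y⁆⇒x≢y e∉⁅o*⁆))

  cT≤D : cost c T ≤ cost c OPT - c o*
  cT≤D = cost-∩∁-≤ c 0≤c o*∈OPT (q⊆p∪q S ⁅ o* ⁆ (x∈⁅x⁆ o*))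

  0<D : 0# < cost c OPT - c o*
  0<D = <-≤-trans (c>0 v) (≤-trans (∈⇒≤cost c 0≤c T v∈T) cT≤D)
    where
    v∈T : v ∈ T
    v∈T = x∈p∩q⁺ (v∈OPT , x∉p⇒x∈∁p (x∉p∪q⁺ v∉S (x≢y⇒x∉⁅y⁆ v≢o*)))

  0≤r : 0# ≤ r
  0≤r = *-nonneg (x≤y⇒0≤y-x (mono S (S ∪ ⁅ v ⁆) (p⊆p∪q ⁅ v ⁆))) (⁻¹-nonNeg (c>0 v))
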